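{- Let $k\geqslant 2$ be an integer. For every finite simple graph $G$ having no subgraph isomorphic to the complete graph $K_{k+1}$, $$\mathrm{cw}(G)\geqslant \frac{k}{k-1}\cdot\frac{\delta(G)^2}{4}-\frac{k-1}{k}.$$
   Context: Cutwidth: for a graph $G=(V,E)$ and a linear ordering $\mathcal{O}=(x_1<\cdots<x_n)$ of $V$, set $\mathrm{cw}(G,\mathcal{O})=\max_{1\leqslant i\leqslant n}\#\{uv\in E : u\leqslant x_i<v\}$, and $\mathrm{cw}(G)=\min_{\mathcal{O}}\mathrm{cw}(G,\mathcal{O})$ over all linear orderings of $V$. Degeneracy: for an integer $k$, the $k$-core of $G$ is the subgraph obtained by recursively deleting vertices of degree strictly less than $k$; the degeneracy $\delta(G)$ is the largest $k$ such that the $k$-core of $G$ is nonempty. -}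

module Defs where

open import Data.Nat using (ℕ; zero; suc; _+_; _*_; _∸_; _≤_; _⊔_; _≤ᵇ_; _<ᵇ_)
open import Data.Bool using (Bool; true; false; _∧_; if_then_else_)
open import Data.Fin using (Fin; toℕ)
open import Data.Fin.Permutation using (Permutation′; _⟨$⟩ʳ_)
open import Data.List using (List; map; foldr)
open import Data.Nat.ListAction using (sum)
open import Data.List using () renaming (allFin to allFinL)
open import Data.Product using (Σ; ∃; _×_)
open import Function.Definitions using (Injective)
open import Relation.Binary.PropositionalEquality using (_≡_; _≢_)
open import Relation.Nullary using (¬_)

record Graph (n : ℕ) : Set where
  field
    adj   : Fin n → Fin n → Bool
    sym   : ∀ u v → adj u v ≡ adj v u
    irref : ∀ v → adj v v ≡ false
open Graph public

count : {n : ℕ} → (Fin n → Bool) → ℕ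
count {n} p = sum (map (λ x → if p x then 1 else 0) (allFinL n))

-- maximum over Fin n (0 when n = 0)
maxFin : {n : ℕ} → (Fin n → ℕ) → ℕ
maxFin {n} f = foldr _⊔_ 0 (map f (allFinL n))

-- Cutwidth
-- A linear ordering O = (x_1 < ... < x_n) of V is a permutation π;
-- the position of vertex v is  π ⟨$⟩ʳ v  (so x_i is the vertex at position i).

-- number of edges uv with  u ≤ x_i < v  (pos u ≤ i < pos v); each edge
-- is counted once since its orientation is fixed by the positions.
cutAt : {n : ℕ} → Graph n → Permutation′ n → Fin n → ℕ
cutAt {n} G π i =
  sum (map (λ u → count (λ v →
      adj G u v ∧ (toℕ (π ⟨$⟩ʳ u) ≤ᵇ toℕ i) ∧ (toℕ i <ᵇ toℕ (π ⟨$⟩ʳ v))))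
    (allFinL n))

cwOrd : {n : ℕ} → Graph n → Permutation′ n → ℕ
cwOrd G π = maxFin (cutAt G π)

IsCutwidth : {n : ℕ} → Graph n → ℕ → Set
IsCutwidth G w = (∃ λ π → cwOrd G π ≡ w) × (∀ π → w ≤ cwOrd G π)

-- Degeneracy via the k-core (recursive deletion of vertices of degree < k)

degIn : {n : ℕ} → Graph n → (Fin n → Bool) → Fin n → ℕ
degIn G S v = count (λ u → S u ∧ adj G v u)

peel : {n : ℕ} → Graph n → ℕ → (Fin n → Bool) → (Fin n → Bool)
peel G k S v = S v ∧ (k ≤ᵇ degIn G S v)

iter : {A : Set} → ℕ → (A → A) → A → A
iter zero f a = a
iter (suc m) f a = iter m f (f a)

-- the k-core: after n rounds (each non-final round deletes ≥ 1 vertex) the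
-- process has stabilised.
core : {n : ℕ} → Graph n → ℕ → (Fin n → Bool)
core {n} G k = iter n (peel G k) (λ _ → true)

CoreNonempty : {n : ℕ} → Graph n → ℕ → Set
CoreNonempty G k = ∃ λ v → core G k v ≡ true

IsDegeneracy : {n : ℕ} → Graph n → ℕ → Set
IsDegeneracy G d = CoreNonempty G d × (∀ k → CoreNonempty G k → k ≤ d)

HasClique : {n : ℕ} → Graph n → ℕ → Set
HasClique {n} G m = Σ (Fin m → Fin n) λ f →
  Injective _≡_ _≡_ f × (∀ i j → i ≢ j → adj G (f i) (f j) ≡ true)

-- Idea.  Inside the δ-core sits a nonempty vertex set S of minimum degree d = δ(G).
-- Fix an ordering of cutwidth w and let X be the part of S lying in an initial
-- segment of the ordering, with t = ∣X∣.  Counting ordered adjacent pairs,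
--   t·d ≤ pairs(X,S) = pairs(X,X) + pairs(X,S∖X) ≤ (k-1)/k·t² + w,
-- where pairs(X,X) is bounded by Turán's theorem (X is K_{k+1}-free) and the pairs
-- from X to S∖X cross one cut of the ordering.  Initial segments realise every size
-- t ≤ ∣S∣, and taking t = ⌊kd/(2(k-1))⌋ ≤ d and completing the square gives the bound.

module Submission where

open import Defs hiding (sym)
open import Data.Nat
  using (ℕ; zero; suc; _+_; _*_; _∸_; _⊔_; _≤_; _<_; _≤ᵇ_; _<ᵇ_; _≡ᵇ_; z≤n; s≤s; s≤s⁻¹)
open import Data.Nat.Properties
open import Data.Nat.Tactic.RingSolver using (solve-∀)
open import Data.Nat.ListAction using (sum)
open import Algebra.Properties.Semiring.Sum +-*-semiring
  using (sum-syntax; ∑-distrib-+; ∑-comm; sum-cong-≗; *-distribˡ-sum; *-distribʳ-sum)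
open import Data.Bool using (Bool; true; false; _∧_; not; if_then_else_; T)
open import Data.Fin using (Fin; zero; suc; toℕ; fromℕ<)
import Data.Fin.Properties as Fin
open import Data.Fin.Permutation using (Permutation′; _⟨$⟩ʳ_; _⟨$⟩ˡ_; inverseˡ)
import Data.Bool.Properties as Bool
import Data.List.Membership.Propositional as List
open import Data.List.Membership.Propositional.Properties using (∈-map⁺; ∈-allFin)
open import Data.List.Relation.Unary.Any using (here; there)
open import Data.List using (map; foldr; tabulate) renaming (allFin to allFinL)
open import Data.List.Properties using (map-tabulate)
open import Data.Product using (Σ; ∃; _×_; _,_)
open import Data.Nat.DivMod using (_/_; _%_; m≡m%n+[m/n]*n; m%n<n)
open import Data.Sum using (_⊎_; inj₁; inj₂)
open import Data.Empty using (⊥; ⊥-elim)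
open import Function.Definitions using (Injective)
open import Function using (_∘_; id)
open import Relation.Binary.PropositionalEquality
open import Relation.Nullary using (¬_; yes; no)

sum-allFin : ∀ n (f : Fin n → ℕ) → sum (map f (allFinL n)) ≡ ∑[ i < n ] f i
sum-allFin n f = trans (cong sum (map-tabulate id f)) (sum-tabulate f)
  where
  sum-tabulate : ∀ {n} (f : Fin n → ℕ) → sum (tabulate f) ≡ ∑[ i < n ] f i
  sum-tabulate {zero}  f = refl
  sum-tabulate {suc n} f = cong (f zero +_) (sum-tabulate (f ∘ suc))

∑-mono : ∀ {n} {f g : Fin n → ℕ} → (∀ i → f i ≤ g i) → ∑[ i < n ] f i ≤ ∑[ i < n ] g i
∑-mono {zero}  f≤g = z≤n
∑-mono {suc n} f≤g = +-mono-≤ (f≤g zero) (∑-mono (f≤g ∘ suc))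

∑-mono-< : ∀ {n} {f g : Fin n → ℕ} → (∀ i → f i ≤ g i) → ∀ j → f j < g j →
           ∑[ i < n ] f i < ∑[ i < n ] g i
∑-mono-< f≤g zero    f<g = +-mono-<-≤ f<g (∑-mono (f≤g ∘ suc))
∑-mono-< f≤g (suc j) f<g = +-mono-≤-< (f≤g zero) (∑-mono-< (f≤g ∘ suc) j f<g)

term≤∑ : ∀ {n} (f : Fin n → ℕ) j → f j ≤ ∑[ i < n ] f i
term≤∑ f zero    = m≤m+n _ _
term≤∑ f (suc j) = ≤-trans (term≤∑ (f ∘ suc) j) (m≤n+m _ _)

∑-positive : ∀ {n} (f : Fin n → ℕ) → 0 < ∑[ i < n ] f i → ∃ λ j → 0 < f j
∑-positive {suc n} f pos with f zero in eq
... | suc _ = zero , subst (0 <_) (sym eq) (s≤s z≤n)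
... | zero  = let (j , 0<fj) = ∑-positive (f ∘ suc) pos in suc j , 0<fj

≤-maxFin : ∀ {n} (f : Fin n → ℕ) i → f i ≤ maxFin f
≤-maxFin {n} f i = ∈⇒≤foldr⊔ (∈-map⁺ f (∈-allFin i))
  where
  ∈⇒≤foldr⊔ : ∀ {x xs} → x List.∈ xs → x ≤ foldr _⊔_ 0 xs
  ∈⇒≤foldr⊔ (here refl) = m≤m⊔n _ _
  ∈⇒≤foldr⊔ (there x∈) = ≤-trans (∈⇒≤foldr⊔ x∈) (m≤n⊔m _ _)

true-and-false : ∀ {b} → b ≡ true → b ≡ false → ⊥
true-and-false refl ()

ind : Bool → ℕ
ind b = if b then 1 else 0

ind-split : ∀ a b → ind a ≡ ind (a ∧ b) + ind (a ∧ not b)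
ind-split false b     = refl
ind-split true  true  = refl
ind-split true  false = refl

ind-mono : ∀ {a b} → (a ≡ true → b ≡ true) → ind a ≤ ind b
ind-mono {false} a⇒b = z≤n
ind-mono {true}  a⇒b rewrite a⇒b refl = ≤-refl

∧-swapʳ : ∀ a b c → (a ∧ b) ∧ c ≡ (a ∧ c) ∧ b
∧-swapʳ false b c = refl
∧-swapʳ true  b c = Bool.∧-comm b c

ind-weight-mono : ∀ b {p q} → (b ≡ true → p ≤ q) → ind b * p ≤ ind b * q
ind-weight-mono false p≤q = z≤n
ind-weight-mono true  p≤q = *-monoʳ-≤ 1 (p≤q refl)

ind-pair-swap : ∀ a b e → ind a * ind (b ∧ e) ≡ ind b * ind (a ∧ e)
ind-pair-swap false false e = refl
ind-pair-swap false true  e = refl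
ind-pair-swap true  false e = refl
ind-pair-swap true  true  e = refl

ind-weight-≤ : ∀ b {p q} → (b ≡ true → p ≤ q) → ind b * p ≤ q
ind-weight-≤ false p≤q = z≤n
ind-weight-≤ true  p≤q = subst (_≤ _) (sym (+-identityʳ _)) (p≤q refl)

VertexSet : ℕ → Set
VertexSet n = Fin n → Bool

module _ {n : ℕ} where

  infixl 7 _∩_ _∖_
  infix  4 _⊆_ _∈_

  _∈_ : Fin n → VertexSet n → Set
  x ∈ S = S x ≡ true

  _⊆_ : VertexSet n → VertexSet n → Set
  S ⊆ T = ∀ x → x ∈ S → x ∈ T

  _∩_ _∖_ : VertexSet n → VertexSet n → VertexSet n
  (S ∩ P) x = S x ∧ P x
  (S ∖ P) x = S x ∧ not (P x)

  ∩⊆ˡ : ∀ S P → S ∩ P ⊆ S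
  ∩⊆ˡ S P x x∈ with S x
  ... | true = refl

  ∩⊆ʳ : ∀ S P → S ∩ P ⊆ P
  ∩⊆ʳ S P x x∈ with S x | P x
  ... | true | true = refl

  ∖⊆ : ∀ S P → S ∖ P ⊆ S
  ∖⊆ S P x x∈ with S x
  ... | true = refl

  ∩-monoˡ : ∀ {S T} P → S ⊆ T → S ∩ P ⊆ T ∩ P
  ∩-monoˡ {S} P S⊆T x x∈ with S x in x∈S
  ... | true rewrite S⊆T x x∈S = x∈

  ∣_∣ : VertexSet n → ℕ
  ∣ S ∣ = ∑[ x < n ] ind (S x)

  ∣∣-cong : ∀ {S T : VertexSet n} → (∀ x → S x ≡ T x) → ∣ S ∣ ≡ ∣ T ∣
  ∣∣-cong S≗T = sum-cong-≗ {n} (cong ind ∘ S≗T)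

  ∣∣-split : ∀ (S P : VertexSet n) → ∣ S ∣ ≡ ∣ S ∩ P ∣ + ∣ S ∖ P ∣
  ∣∣-split S P = trans (sum-cong-≗ {n} (λ x → ind-split (S x) (P x)))
                       (∑-distrib-+ (ind ∘ (S ∩ P)) (ind ∘ (S ∖ P)))

  ∣∣-mono : ∀ {S T : VertexSet n} → S ⊆ T → ∣ S ∣ ≤ ∣ T ∣
  ∣∣-mono S⊆T = ∑-mono (λ x → ind-mono (S⊆T x))

  ∈⇒∣∣-positive : ∀ {S : VertexSet n} {x} → x ∈ S → 0 < ∣ S ∣
  ∈⇒∣∣-positive {S} {x} x∈S = ≤-trans (≤-reflexive (cong ind (sym x∈S))) (term≤∑ (ind ∘ S) x)

  ∣∣-positive⇒∈ : ∀ {S : VertexSet n} → 0 < ∣ S ∣ → ∃ λ x → x ∈ S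
  ∣∣-positive⇒∈ {S} pos with ∑-positive (ind ∘ S) pos
  ... | x , 0<ind with S x in x∈S
  ...   | true = x , x∈S

  ⊆-size-eq : ∀ {S T : VertexSet n} → S ⊆ T → ∣ T ∣ ≤ ∣ S ∣ → T ⊆ S
  ⊆-size-eq {S} {T} S⊆T ∣T∣≤∣S∣ x x∈T with S x in x∈S
  ... | true  = refl
  ... | false = ⊥-elim (<⇒≱ (∑-mono-< (λ y → ind-mono (S⊆T y)) x ind<) ∣T∣≤∣S∣)
    where
    ind< : ind (S x) < ind (T x)
    ind< rewrite x∈S | x∈T = s≤s z≤n

∣∣-empty : ∀ {n} (S : VertexSet n) → (∀ x → S x ≡ false) → ∣ S ∣ ≡ 0
∣∣-empty {zero}  S empty = refl
∣∣-empty {suc n} S empty rewrite empty zero = ∣∣-empty (S ∘ suc) (empty ∘ suc)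

∣∣-full : ∀ n → ∣ (λ (_ : Fin n) → true) ∣ ≡ n
∣∣-full zero    = refl
∣∣-full (suc n) = cong suc (∣∣-full n)

∣∣-subsingleton : ∀ {n} (S : VertexSet n) → (∀ x y → x ∈ S → y ∈ S → x ≡ y) → ∣ S ∣ ≤ 1
∣∣-subsingleton {zero}  S unique = z≤n
∣∣-subsingleton {suc n} S unique with S zero in 0∈S
... | false = ∣∣-subsingleton (S ∘ suc) (λ x y x∈ y∈ → Fin.suc-injective (unique _ _ x∈ y∈))
... | true  = s≤s (≤-reflexive (∣∣-empty (S ∘ suc) notSuc))
  where
  notSuc : ∀ x → S (suc x) ≡ false
  notSuc x with S (suc x) in x∈S
  ... | false = refl
  ... | true with unique zero (suc x) 0∈S x∈S
  ...   | ()

maximiser : ∀ {n} (S : VertexSet n) (f : Fin n → ℕ) →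
            (∀ x → S x ≡ false) ⊎ (∃ λ v → v ∈ S × (∀ u → u ∈ S → f u ≤ f v))
maximiser {zero}  S f = inj₁ λ ()
maximiser {suc n} S f with maximiser (S ∘ suc) (f ∘ suc) | S zero in 0∈S
... | inj₁ empty | false = inj₁ λ { zero → 0∈S ; (suc x) → empty x }
... | inj₁ empty | true  = inj₂ (zero , 0∈S , λ
  { zero    _   → ≤-refl
  ; (suc u) u∈S → ⊥-elim (true-and-false u∈S (empty u)) })
... | inj₂ (v , v∈S , max) | false = inj₂ (suc v , v∈S , λ
  { zero    0∈S′ → ⊥-elim (true-and-false 0∈S′ 0∈S)
  ; (suc u)      → max u })
... | inj₂ (v , v∈S , max) | true with f (suc v) ≤? f zero
...   | yes fv≤f0 = inj₂ (zero , 0∈S , λ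
  { zero    _   → ≤-refl
  ; (suc u) u∈S → ≤-trans (max u u∈S) fv≤f0 })
...   | no  fv≰f0 = inj₂ (suc v , v∈S , λ
  { zero    _ → <⇒≤ (≰⇒> fv≰f0)
  ; (suc u)   → max u })

module _ {n : ℕ} (G : Graph n) where

  deg : VertexSet n → Fin n → ℕ
  deg S v = ∣ S ∩ adj G v ∣

  edges : VertexSet n → VertexSet n → ℕ
  edges X Y = ∑[ x < n ] (ind (X x) * deg Y x)

  degIn≡deg : ∀ S v → degIn G S v ≡ deg S v
  degIn≡deg S v = sum-allFin n (ind ∘ (S ∩ adj G v))

  deg-split : ∀ S P v → deg S v ≡ deg (S ∩ P) v + deg (S ∖ P) v
  deg-split S P v = begin
    ∣ S ∩ adj G v ∣
      ≡⟨ ∣∣-split (S ∩ adj G v) P ⟩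
    ∣ S ∩ adj G v ∩ P ∣ + ∣ (S ∩ adj G v) ∖ P ∣
      ≡⟨ cong₂ _+_ (∣∣-cong λ x → ∧-swapʳ (S x) _ (P x)) (∣∣-cong λ x → ∧-swapʳ (S x) _ (not (P x))) ⟩
    ∣ S ∩ P ∩ adj G v ∣ + ∣ (S ∖ P) ∩ adj G v ∣ ∎
    where open ≡-Reasoning

  deg-mono : ∀ {S T} → S ⊆ T → ∀ v → deg S v ≤ deg T v
  deg-mono S⊆T v = ∣∣-mono (∩-monoˡ (adj G v) S⊆T)

  deg≤size : ∀ S v → deg S v ≤ ∣ S ∣
  deg≤size S v = ∣∣-mono (∩⊆ˡ S (adj G v))

  edges-splitˡ : ∀ S P Y → edges S Y ≡ edges (S ∩ P) Y + edges (S ∖ P) Y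
  edges-splitˡ S P Y = trans (sum-cong-≗ {n} split) (∑-distrib-+ (weight (S ∩ P)) (weight (S ∖ P)))
    where
    weight : VertexSet n → Fin n → ℕ
    weight X x = ind (X x) * deg Y x
    split : ∀ x → weight S x ≡ weight (S ∩ P) x + weight (S ∖ P) x
    split x = trans (cong (_* deg Y x) (ind-split (S x) (P x)))
                    (*-distribʳ-+ (deg Y x) (ind ((S ∩ P) x)) (ind ((S ∖ P) x)))

  edges-splitʳ : ∀ X S P → edges X S ≡ edges X (S ∩ P) + edges X (S ∖ P)
  edges-splitʳ X S P = trans (sum-cong-≗ {n} split) (∑-distrib-+ (weight (S ∩ P)) (weight (S ∖ P)))
    where
    weight : VertexSet n → Fin n → ℕ
    weight Y x = ind (X x) * deg Y x
    split : ∀ x → weight S x ≡ weight (S ∩ P) x + weight (S ∖ P) x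
    split x = trans (cong (ind (X x) *_) (deg-split S P x))
                    (*-distribˡ-+ (ind (X x)) (deg (S ∩ P) x) (deg (S ∖ P) x))

  edges-monoʳ : ∀ X {Y Y′} → Y ⊆ Y′ → edges X Y ≤ edges X Y′
  edges-monoʳ X Y⊆Y′ = ∑-mono λ x → ind-weight-mono (X x) (λ _ → deg-mono Y⊆Y′ x)

  edges-≤ : ∀ X Y D → (∀ x → x ∈ X → deg Y x ≤ D) → edges X Y ≤ ∣ X ∣ * D
  edges-≤ X Y D bound = ≤-trans (∑-mono λ x → ind-weight-mono (X x) (bound x))
                                (≤-reflexive (sym (*-distribʳ-sum D (ind ∘ X))))

  edges-≥ : ∀ X Y D → (∀ x → x ∈ X → D ≤ deg Y x) → ∣ X ∣ * D ≤ edges X Y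
  edges-≥ X Y D bound = ≤-trans (≤-reflexive (*-distribʳ-sum D (ind ∘ X)))
                                (∑-mono λ x → ind-weight-mono (X x) (bound x))

  -- Double counting: adjacency is symmetric.
  edges-sym : ∀ X Y → edges X Y ≡ edges Y X
  edges-sym X Y = begin
    edges X Y
      ≡⟨ sum-cong-≗ {n} (λ x → *-distribˡ-sum (ind (X x)) (pairs Y x)) ⟩
    ∑[ x < n ] ∑[ y < n ] (ind (X x) * ind (Y y ∧ adj G x y))
      ≡⟨ ∑-comm (λ x y → ind (X x) * ind (Y y ∧ adj G x y)) ⟩
    ∑[ y < n ] ∑[ x < n ] (ind (X x) * ind (Y y ∧ adj G x y))
      ≡⟨ sum-cong-≗ {n} (λ y → sum-cong-≗ {n} (swap y)) ⟩
    ∑[ y < n ] ∑[ x < n ] (ind (Y y) * ind (X x ∧ adj G y x))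
      ≡⟨ sum-cong-≗ {n} (λ y → *-distribˡ-sum (ind (Y y)) (pairs X y)) ⟨
    edges Y X ∎
    where
    open ≡-Reasoning
    pairs : VertexSet n → Fin n → Fin n → ℕ
    pairs Z v u = ind (Z u ∧ adj G v u)
    swap : ∀ y x → ind (X x) * ind (Y y ∧ adj G x y) ≡ ind (Y y) * ind (X x ∧ adj G y x)
    swap y x rewrite Graph.sym G x y = ind-pair-swap (X x) (Y y) (adj G y x)

module _ {n : ℕ} (G : Graph n) where

  record CliqueIn (S : VertexSet n) (m : ℕ) : Set where
    field
      vertex   : Fin m → Fin n
      distinct : Injective _≡_ _≡_ vertex
      inside   : ∀ i → vertex i ∈ S
      adjacent : ∀ i j → i ≢ j → adj G (vertex i) (vertex j) ≡ true
  open CliqueIn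

  noClique : ∀ {m} → ¬ HasClique G m → ∀ S → ¬ CliqueIn S m
  noClique noK S K = noK (vertex K , distinct K , adjacent K)

  adj⇒≢ : ∀ {x y} → adj G x y ≡ true → x ≢ y
  adj⇒≢ {x} x~x refl = true-and-false x~x (irref G x)

  singleton : ∀ {S v} → v ∈ S → CliqueIn S 1
  singleton {v = v} v∈S = record
    { vertex = λ _ → v ; distinct = λ { {zero} {zero} _ → refl }
    ; inside = λ _ → v∈S ; adjacent = λ { zero zero 0≢0 → ⊥-elim (0≢0 refl) } }

  extend : ∀ {S v m} → v ∈ S → CliqueIn (S ∩ adj G v) m → CliqueIn S (suc m)
  extend {S} {v} {m} v∈S K = record
    { vertex = vertex′ ; distinct = distinct′ ; inside = inside′ ; adjacent = adjacent′ }
    where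
    v~ : ∀ i → adj G v (vertex K i) ≡ true
    v~ i = ∩⊆ʳ S (adj G v) (vertex K i) (inside K i)
    vertex′ : Fin (suc m) → Fin n
    vertex′ zero    = v
    vertex′ (suc i) = vertex K i
    distinct′ : Injective _≡_ _≡_ vertex′
    distinct′ {zero}  {zero}  _  = refl
    distinct′ {zero}  {suc j} eq = ⊥-elim (adj⇒≢ (v~ j) eq)
    distinct′ {suc i} {zero}  eq = ⊥-elim (adj⇒≢ (v~ i) (sym eq))
    distinct′ {suc i} {suc j} eq = cong suc (distinct K eq)
    inside′ : ∀ i → vertex′ i ∈ S
    inside′ zero    = v∈S
    inside′ (suc i) = ∩⊆ˡ S (adj G v) (vertex K i) (inside K i)
    adjacent′ : ∀ i j → i ≢ j → adj G (vertex′ i) (vertex′ j) ≡ true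
    adjacent′ zero    zero    i≢j = ⊥-elim (i≢j refl)
    adjacent′ zero    (suc j) _   = v~ j
    adjacent′ (suc i) zero    _   = trans (Graph.sym G (vertex K i) v) (v~ i)
    adjacent′ (suc i) (suc j) i≢j = adjacent K i j (i≢j ∘ cong suc)

-- The Turán bound

-- AM-GM in the form 2xy ≤ x² + y²: for x ≤ y write y = x + c, then x² + y² = 2xy + c².
2xy≤x²+y²-ordered : ∀ {x y} → x ≤ y → 2 * (x * y) ≤ x * x + y * y
2xy≤x²+y²-ordered {x} {y} x≤y =
  subst (λ z → 2 * (x * z) ≤ x * x + z * z) (m+[n∸m]≡n x≤y)
        (subst (2 * (x * (x + c)) ≤_) (square-gap x c) (m≤m+n _ (c * c)))
  where
  c : ℕ
  c = y ∸ x
  square-gap : ∀ x c → 2 * (x * (x + c)) + c * c ≡ x * x + (x + c) * (x + c)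
  square-gap = solve-∀

2xy≤x²+y² : ∀ x y → 2 * (x * y) ≤ x * x + y * y
2xy≤x²+y² x y with ≤-total x y
... | inj₁ x≤y = 2xy≤x²+y²-ordered x≤y
... | inj₂ y≤x = subst₂ _≤_ (cong (2 *_) (*-comm y x)) (+-comm (y * y) (x * x)) (2xy≤x²+y²-ordered y≤x)

-- The arithmetic of one induction step of the Turán bound: if the pairs inside the
-- neighbourhood (Δ vertices) obey the bound for K_{m+1}-free sets and the remaining
-- b vertices contribute at most 2bΔ pairs, then the bound for K_{m+2}-free sets holds.
turán-step-arith : ∀ m X Δ b E → suc m * X ≤ m * (Δ * Δ) → E ≤ X + 2 * (b * Δ) →
                   suc (suc m) * E ≤ suc m * ((Δ + b) * (Δ + b))
turán-step-arith m X Δ b E ih E≤ = *-cancelˡ-≤ (suc m) (+-cancelʳ-≤ Z _ _ chain)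
  where
  Z : ℕ
  Z = Δ * Δ + ((1 + m) * b) * ((1 + m) * b)
  expand : ∀ m X Δ b → (1 + m) * ((2 + m) * (X + 2 * (b * Δ)))
                     ≡ (2 + m) * ((1 + m) * X) + (1 + m) * (2 + m) * 2 * (b * Δ)
  expand = solve-∀
  complete-square : ∀ m Δ b → (2 + m) * (m * (Δ * Δ)) + (1 + m) * (2 + m) * 2 * (b * Δ)
                                + (Δ * Δ + ((1 + m) * b) * ((1 + m) * b))
                            ≡ (1 + m) * ((1 + m) * ((Δ + b) * (Δ + b))) + 2 * (Δ * ((1 + m) * b))
  complete-square = solve-∀
  open ≤-Reasoning
  chain : (1 + m) * ((2 + m) * E) + Z ≤ (1 + m) * ((1 + m) * ((Δ + b) * (Δ + b))) + Z
  chain = begin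
    (1 + m) * ((2 + m) * E) + Z
      ≤⟨ +-monoˡ-≤ Z (*-monoʳ-≤ (1 + m) (*-monoʳ-≤ (2 + m) E≤)) ⟩
    (1 + m) * ((2 + m) * (X + 2 * (b * Δ))) + Z
      ≡⟨ cong (_+ Z) (expand m X Δ b) ⟩
    (2 + m) * ((1 + m) * X) + (1 + m) * (2 + m) * 2 * (b * Δ) + Z
      ≤⟨ +-monoˡ-≤ Z (+-monoˡ-≤ ((1 + m) * (2 + m) * 2 * (b * Δ)) (*-monoʳ-≤ (2 + m) ih)) ⟩
    (2 + m) * (m * (Δ * Δ)) + (1 + m) * (2 + m) * 2 * (b * Δ) + Z
      ≡⟨ complete-square m Δ b ⟩
    (1 + m) * ((1 + m) * ((Δ + b) * (Δ + b))) + 2 * (Δ * ((1 + m) * b))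
      ≤⟨ +-monoʳ-≤ ((1 + m) * ((1 + m) * ((Δ + b) * (Δ + b)))) (2xy≤x²+y² Δ ((1 + m) * b)) ⟩
    (1 + m) * ((1 + m) * ((Δ + b) * (Δ + b))) + Z ∎

module _ {n : ℕ} (G : Graph n) where

  -- Split S at the neighbourhood A of a vertex v of maximum degree in S.  Every
  -- vertex of B = S ∖ A has at most ∣A∣ = deg S v neighbours in S, so
  -- pairs(S,S) = pairs(A,A) + pairs(A,B) + pairs(B,S) ≤ pairs(A,A) + 2∣B∣∣A∣.
  edges-maxDegree-split : ∀ S v → (∀ u → u ∈ S → deg G S u ≤ deg G S v) →
    let A = S ∩ adj G v ; B = S ∖ adj G v in
    edges G S S ≤ edges G A A + 2 * (∣ B ∣ * ∣ A ∣)
  edges-maxDegree-split S v maxDeg = begin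
    edges G S S
      ≡⟨ edges-splitˡ G S (adj G v) S ⟩
    edges G A S + edges G B S
      ≡⟨ cong (_+ edges G B S) (edges-splitʳ G A S (adj G v)) ⟩
    edges G A A + edges G A B + edges G B S
      ≡⟨ cong (λ z → edges G A A + z + edges G B S) (edges-sym G A B) ⟩
    edges G A A + edges G B A + edges G B S
      ≤⟨ +-monoˡ-≤ (edges G B S) (+-monoʳ-≤ (edges G A A) (edges-monoʳ G B (∩⊆ˡ S (adj G v)))) ⟩
    edges G A A + edges G B S + edges G B S
      ≤⟨ +-mono-≤ (+-monoʳ-≤ (edges G A A) B→S) B→S ⟩
    edges G A A + ∣ B ∣ * ∣ A ∣ + ∣ B ∣ * ∣ A ∣
      ≡⟨ +-assoc (edges G A A) _ _ ⟩
    edges G A A + (∣ B ∣ * ∣ A ∣ + ∣ B ∣ * ∣ A ∣)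
      ≡⟨ cong (λ z → edges G A A + (∣ B ∣ * ∣ A ∣ + z)) (+-identityʳ _) ⟨
    edges G A A + 2 * (∣ B ∣ * ∣ A ∣) ∎
    where
    open ≤-Reasoning
    A B : VertexSet n
    A = S ∩ adj G v
    B = S ∖ adj G v
    B→S : edges G B S ≤ ∣ B ∣ * ∣ A ∣
    B→S = edges-≤ G B S ∣ A ∣ (λ u u∈B → maxDeg u (∖⊆ S (adj G v) u u∈B))

  turán : ∀ m S → ¬ CliqueIn G S (2 + m) → suc m * edges G S S ≤ m * (∣ S ∣ * ∣ S ∣)
  turán zero S noK₂ = subst₂ _≤_ (sym (+-identityʳ _)) (*-zeroʳ ∣ S ∣) (edges-≤ G S S 0 noNeighbour)
    where
    noNeighbour : ∀ x → x ∈ S → deg G S x ≤ 0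
    noNeighbour x x∈S = ≮⇒≥ λ 0<deg →
      let (u , u∈) = ∣∣-positive⇒∈ {S = S ∩ adj G x} 0<deg in noK₂ (extend G x∈S (singleton G u∈))
  turán (suc m) S noK with maximiser S (deg G S)
  ... | inj₁ empty =
    ≤-trans (*-monoʳ-≤ (suc (suc m)) noPairs) (≤-trans (≤-reflexive (*-zeroʳ (suc (suc m)))) z≤n)
    where
    noPairs : edges G S S ≤ 0
    noPairs = subst (edges G S S ≤_) (cong (_* ∣ S ∣) (∣∣-empty S empty))
                 (edges-≤ G S S ∣ S ∣ (λ x _ → deg≤size G S x))
  ... | inj₂ (v , v∈S , maxDeg) =
    subst (λ z → suc (suc m) * edges G S S ≤ suc m * (z * z)) (sym (∣∣-split S (adj G v)))
      (turán-step-arith m (edges G A A) ∣ A ∣ ∣ S ∖ adj G v ∣ (edges G S S)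
        (turán m A (noK ∘ extend G v∈S)) (edges-maxDegree-split S v maxDeg))
    where
    A : VertexSet n
    A = S ∩ adj G v

-- The d-core contains a nonempty set of minimum degree at least d

plateau-or-drop : (c : ℕ → ℕ) → (∀ j → c (suc j) ≤ c j) →
                  ∀ m → (∃ λ i → i < m × c i ≤ c (suc i)) ⊎ (c m + m ≤ c 0)
plateau-or-drop c dec zero = inj₂ (≤-reflexive (+-identityʳ (c 0)))
plateau-or-drop c dec (suc m) with plateau-or-drop c dec m
... | inj₁ (i , i<m , plateau) = inj₁ (i , m<n⇒m<1+n i<m , plateau)
... | inj₂ dropped with c m ≤? c (suc m)
...   | yes plateau = inj₁ (m , n<1+n m , plateau)
...   | no  drop    = inj₂ (begin
        c (suc m) + suc m ≡⟨ +-suc (c (suc m)) m ⟩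
        suc (c (suc m)) + m ≤⟨ +-monoˡ-≤ m (≰⇒> drop) ⟩
        c m + m           ≤⟨ dropped ⟩
        c 0               ∎)
  where open ≤-Reasoning

iter-suc : ∀ {A : Set} j (f : A → A) a → iter (suc j) f a ≡ f (iter j f a)
iter-suc zero    f a = refl
iter-suc (suc j) f a = iter-suc j f (f a)

module _ {n : ℕ} (G : Graph n) (d : ℕ) where

  peeled : ℕ → VertexSet n
  peeled j = iter j (peel G d) (λ _ → true)

  peeled-suc : ∀ j → peeled (suc j) ≡ peeled j ∩ (λ v → d ≤ᵇ degIn G (peeled j) v)
  peeled-suc j = iter-suc j (peel G d) (λ _ → true)

  peeled-⊆-suc : ∀ j → peeled (suc j) ⊆ peeled j
  peeled-⊆-suc j rewrite peeled-suc j = ∩⊆ˡ (peeled j) _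

  peeled-⊆ : ∀ {i j} → i ≤ j → peeled j ⊆ peeled i
  peeled-⊆ {j = zero}  z≤n = λ _ v∈ → v∈
  peeled-⊆ {i} {suc j} i≤1+j with m≤n⇒m<n∨m≡n i≤1+j
  ... | inj₁ i<1+j = λ v v∈ → peeled-⊆ (s≤s⁻¹ i<1+j) v (peeled-⊆-suc j v v∈)
  ... | inj₂ refl  = λ _ v∈ → v∈

  plateau⇒minDegree : ∀ j → ∣ peeled j ∣ ≤ ∣ peeled (suc j) ∣ →
                      ∀ u → u ∈ peeled j → d ≤ deg G (peeled j) u
  plateau⇒minDegree j plateau u u∈ =
    subst (d ≤_) (degIn≡deg G (peeled j) u) (≤ᵇ⇒≤ d _ (subst T (sym survives) _))
    where
    survives : (d ≤ᵇ degIn G (peeled j) u) ≡ true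
    survives = ∩⊆ʳ (peeled j) (λ v → d ≤ᵇ degIn G (peeled j) v) u (subst (u ∈_) (peeled-suc j)
                 (⊆-size-eq (peeled-⊆-suc j) plateau u u∈))

  -- Peeling stabilises within n rounds, so a nonempty d-core yields a nonempty
  -- vertex set in which every vertex has at least d neighbours.
  minDegreeSet : CoreNonempty G d →
    Σ (VertexSet n) λ S → (∃ λ v → v ∈ S) × (∀ u → u ∈ S → d ≤ deg G S u)
  minDegreeSet (v , v∈core) with plateau-or-drop (∣_∣ ∘ peeled) (∣∣-mono ∘ peeled-⊆-suc) n
  ... | inj₁ (i , i<n , plateau) =
    peeled i , (v , peeled-⊆ (<⇒≤ i<n) v v∈core) , plateau⇒minDegree i plateau
  ... | inj₂ dropped = ⊥-elim (<⇒≱ (+-monoˡ-≤ n (∈⇒∣∣-positive {S = peeled n} v∈core))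
                                   (subst (∣ peeled n ∣ + n ≤_) (∣∣-full n) dropped))

-- Prefixes of a linear ordering and the cuts between them

discrete-ivt : (f : ℕ → ℕ) → (∀ j → f (suc j) ≤ suc (f j)) →
               ∀ {t} m → f 0 ≤ t → t ≤ f m → ∃ λ j → j ≤ m × f j ≡ t
discrete-ivt f step zero    f0≤t t≤fm = 0 , z≤n , ≤-antisym f0≤t t≤fm
discrete-ivt f step {t} (suc m) f0≤t t≤fm with t ≤? f m
... | yes t≤f = let (j , j≤m , fj≡t) = discrete-ivt f step m f0≤t t≤f in j , m≤n⇒m≤1+n j≤m , fj≡t
... | no  t≰f = suc m , ≤-refl , ≤-antisym (≤-trans (step m) (≰⇒> t≰f)) t≤fm

<ᵇ-suc : ∀ p i → (p <ᵇ suc i) ≡ (p ≤ᵇ i)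
<ᵇ-suc zero    i = refl
<ᵇ-suc (suc p) i = refl

not-≤ᵇ : ∀ p i → not (p ≤ᵇ i) ≡ (i <ᵇ p)
not-≤ᵇ zero    i       = refl
not-≤ᵇ (suc p) zero    = refl
not-≤ᵇ (suc p) (suc i) = trans (cong not (<ᵇ-suc p i)) (not-≤ᵇ p i)

<ᵇ-step : ∀ p j → ind (p <ᵇ suc j) ≤ ind (p <ᵇ j) + ind (p ≡ᵇ j)
<ᵇ-step zero    zero    = ≤-refl
<ᵇ-step zero    (suc j) = s≤s z≤n
<ᵇ-step (suc p) zero    = z≤n
<ᵇ-step (suc p) (suc j) = <ᵇ-step p j

-- If x is in X and before the cut (x ∧ a) and y is in X, after the cut (not b)
-- and adjacent to x (e), then the pair crosses the cut.
crossing-term : ∀ x a y b e → x ∧ a ≡ true → ind ((y ∧ not b) ∧ e) ≤ ind (e ∧ a ∧ not b)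
crossing-term true true true  false true  _ = ≤-refl
crossing-term true true true  false false _ = z≤n
crossing-term true true true  true  e     _ = z≤n
crossing-term true true false b     e     _ = z≤n

module _ {n : ℕ} (π : Permutation′ n) where

  pos : Fin n → ℕ
  pos u = toℕ (π ⟨$⟩ʳ u)

  First At : ℕ → VertexSet n
  First j u = pos u <ᵇ j
  At    j u = pos u ≡ᵇ j

  pos-injective : ∀ {x y} → pos x ≡ pos y → x ≡ y
  pos-injective {x} {y} eq = begin
    x                     ≡⟨ inverseˡ π ⟨
    π ⟨$⟩ˡ (π ⟨$⟩ʳ x)     ≡⟨ cong (π ⟨$⟩ˡ_) (Fin.toℕ-injective eq) ⟩
    π ⟨$⟩ˡ (π ⟨$⟩ʳ y)     ≡⟨ inverseˡ π ⟩
    y                     ∎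
    where open ≡-Reasoning

  prefix-step : ∀ S j → ∣ S ∩ First (suc j) ∣ ≤ suc ∣ S ∩ First j ∣
  prefix-step S j = begin
    ∣ S ∩ First (suc j) ∣
      ≤⟨ ∑-mono pointwise ⟩
    ∑[ u < n ] (ind ((S ∩ First j) u) + ind (At j u))
      ≡⟨ ∑-distrib-+ (ind ∘ (S ∩ First j)) (ind ∘ At j) ⟩
    ∣ S ∩ First j ∣ + ∣ At j ∣
      ≤⟨ +-monoʳ-≤ ∣ S ∩ First j ∣ (∣∣-subsingleton (At j) atMostOne) ⟩
    ∣ S ∩ First j ∣ + 1
      ≡⟨ +-comm ∣ S ∩ First j ∣ 1 ⟩
    suc ∣ S ∩ First j ∣ ∎
    where
    open ≤-Reasoning
    pointwise : ∀ u → ind ((S ∩ First (suc j)) u) ≤ ind ((S ∩ First j) u) + ind (At j u)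
    pointwise u with S u
    ... | true  = <ᵇ-step (pos u) j
    ... | false = z≤n
    atMostOne : ∀ x y → x ∈ At j → y ∈ At j → x ≡ y
    atMostOne x y x-at-j y-at-j = pos-injective (trans (≡ᵇ⇒≡ _ _ (subst T (sym x-at-j) _))
                                               (sym (≡ᵇ⇒≡ _ _ (subst T (sym y-at-j) _))))

  prefix-zero : ∀ S → ∣ S ∩ First 0 ∣ ≡ 0
  prefix-zero S = ∣∣-empty (S ∩ First 0) (λ u → Bool.∧-zeroʳ (S u))

  prefix-all : ∀ S → ∣ S ∩ First n ∣ ≡ ∣ S ∣
  prefix-all S = ∣∣-cong λ u → trans (cong (S u ∧_) (before-n u)) (Bool.∧-identityʳ (S u))
    where
    before-n : ∀ u → (pos u <ᵇ n) ≡ true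
    before-n u with pos u <ᵇ n | <⇒<ᵇ (Fin.toℕ<n (π ⟨$⟩ʳ u))
    ... | true | _ = refl

module _ {n : ℕ} (G : Graph n) (π : Permutation′ n) where

  crossing≤cutAt : ∀ X (i : Fin n) → let P = First π (suc (toℕ i)) in
                   edges G (X ∩ P) (X ∖ P) ≤ cutAt G π i
  crossing≤cutAt X i = begin
    edges G (X ∩ P) (X ∖ P)
      ≤⟨ ∑-mono (λ u → ind-weight-≤ ((X ∩ P) u) (λ u∈ → ∑-mono (λ v → term u v u∈))) ⟩
    ∑[ u < n ] ∑[ v < n ] ind (adj G u v ∧ P u ∧ not (P v))
      ≡⟨ sum-cong-≗ {n} (λ u → sum-cong-≗ {n} λ v → cong ind (cong₂ (λ a b → adj G u v ∧ a ∧ b)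
                                    (<ᵇ-suc (pos π u) (toℕ i)) (not≡ v))) ⟩
    ∑[ u < n ] ∑[ v < n ] ind (adj G u v ∧ (pos π u ≤ᵇ toℕ i) ∧ (toℕ i <ᵇ pos π v))
      ≡⟨ trans (sum-allFin n (λ u → count (crosses u)))
               (sum-cong-≗ {n} (λ u → sum-allFin n (ind ∘ crosses u))) ⟨
    cutAt G π i ∎
    where
    open ≤-Reasoning
    P : VertexSet n
    P = First π (suc (toℕ i))
    crosses : Fin n → VertexSet n
    crosses u v = adj G u v ∧ (pos π u ≤ᵇ toℕ i) ∧ (toℕ i <ᵇ pos π v)
    not≡ : ∀ v → not (P v) ≡ (toℕ i <ᵇ pos π v)
    not≡ v = trans (cong not (<ᵇ-suc (pos π v) (toℕ i))) (not-≤ᵇ (pos π v) (toℕ i))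
    term : ∀ u v → (X ∩ P) u ≡ true → ind (((X ∖ P) ∩ adj G u) v) ≤ ind (adj G u v ∧ P u ∧ not (P v))
    term u v u∈ = crossing-term (X u) (P u) (X v) (P v) (adj G u v) u∈

  cutAt≤cwOrd : ∀ i → cutAt G π i ≤ cwOrd G π
  cutAt≤cwOrd = ≤-maxFin (cutAt G π)

-- Cutwidth against minimum degree

module _ {n : ℕ} (G : Graph n) {a : ℕ} (noK : ¬ HasClique G (2 + a))
         {S : VertexSet n} {d : ℕ} (minDeg : ∀ u → u ∈ S → d ≤ deg G S u) where

  -- A part X = S ∩ P with t vertices has t·d ≤ pairs(X,S) = pairs(X,X) + pairs(X,S ∖ P),
  -- and the Turán bound controls pairs(X,X).
  part-bound : ∀ P → let t = ∣ S ∩ P ∣ in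
               suc a * (t * d) ≤ a * (t * t) + suc a * edges G (S ∩ P) (S ∖ P)
  part-bound P = begin
    suc a * (∣ X ∣ * d)                              ≤⟨ *-monoʳ-≤ (suc a) (edges-≥ G X S d minDegX) ⟩
    suc a * edges G X S                              ≡⟨ cong (suc a *_) (edges-splitʳ G X S P) ⟩
    suc a * (edges G X X + edges G X (S ∖ P))        ≡⟨ *-distribˡ-+ (suc a) (edges G X X) _ ⟩
    suc a * edges G X X + suc a * edges G X (S ∖ P)  ≤⟨ +-monoˡ-≤ _ (turán G a X (noClique G noK X)) ⟩
    a * (∣ X ∣ * ∣ X ∣) + suc a * edges G X (S ∖ P)  ∎
    where
    open ≤-Reasoning
    X : VertexSet n
    X = S ∩ P
    minDegX : ∀ u → u ∈ X → d ≤ deg G S u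
    minDegX u u∈X = minDeg u (∩⊆ˡ S P u u∈X)

  -- Taking for X the part of S in the first i+1 positions of an ordering π, the
  -- pairs from X to the rest of S cross the cut after position i.
  prefix-bound : ∀ π (i : Fin n) → let t = ∣ S ∩ First π (suc (toℕ i)) ∣ in
                 suc a * (t * d) ≤ a * (t * t) + suc a * cwOrd G π
  prefix-bound π i =
    ≤-trans (part-bound P) (+-monoʳ-≤ (a * (∣ S ∩ P ∣ * ∣ S ∩ P ∣)) (*-monoʳ-≤ (suc a) crossing≤cw))
    where
    P : VertexSet n
    P = First π (suc (toℕ i))
    crossing≤cw : edges G (S ∩ P) (S ∖ P) ≤ cwOrd G π
    crossing≤cw = ≤-trans (crossing≤cutAt G π S i) (cutAt≤cwOrd G π i)

  -- Since prefixes of S take every size t ≤ ∣S∣, the bound holds for every such t.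
  size-bound : ∀ π t → t ≤ ∣ S ∣ → suc a * d * t ≤ suc a * cwOrd G π + a * (t * t)
  size-bound π zero    _   = ≤-trans (≤-reflexive (*-zeroʳ (suc a * d))) z≤n
  size-bound π (suc t) t≤S with discrete-ivt (λ j → ∣ S ∩ First π j ∣) (prefix-step π S) n
                                 (≤-trans (≤-reflexive (prefix-zero π S)) z≤n)
                                 (subst (suc t ≤_) (sym (prefix-all π S)) t≤S)
  ... | zero  , _     , size≡ = ⊥-elim (0≢1+n (trans (sym (prefix-zero π S)) size≡))
  ... | suc j , j<n   , size≡ = begin
    suc a * d * suc t                          ≡⟨ reorder (suc a) d (suc t) ⟩
    suc a * (suc t * d)                        ≡⟨ cong (λ s → suc a * (s * d)) size≡′ ⟨
    suc a * (s * d)                            ≤⟨ prefix-bound π i ⟩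
    a * (s * s) + suc a * cwOrd G π            ≡⟨ cong (λ s → a * (s * s) + suc a * cwOrd G π) size≡′ ⟩
    a * (suc t * suc t) + suc a * cwOrd G π    ≡⟨ +-comm _ (suc a * cwOrd G π) ⟩
    suc a * cwOrd G π + a * (suc t * suc t)    ∎
    where
    open ≤-Reasoning
    i : Fin n
    i = fromℕ< j<n
    s : ℕ
    s = ∣ S ∩ First π (suc (toℕ i)) ∣
    size≡′ : s ≡ suc t
    size≡′ = trans (cong (λ p → ∣ S ∩ First π (suc p) ∣) (Fin.toℕ-fromℕ< j<n)) size≡
    reorder : ∀ k d t → k * d * t ≡ k * (t * d)
    reorder = solve-∀

-- Completing the square: if kd = r + 2at with r < 2a and kdt ≤ kw + at², then
-- (kd)² + 4a²t² = r² + 4a·kd·t ≤ r² + 4akw + 4a²t², so (kd)² ≤ 4akw + r² < 4akw + 4a².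
completed-square : ∀ a d w t r → let k = suc a in
  k * d ≡ r + t * (2 * a) → r < 2 * a → k * d * t ≤ k * w + a * (t * t) →
  k * k * (d * d) ≤ 4 * k * a * w + 4 * a * a
completed-square a d w t r kd≡ r<2a bound = begin
  k * k * (d * d)                        ≡⟨ square-kd k d ⟩
  (k * d) * (k * d)                      ≡⟨ cong (λ z → z * z) kd≡ ⟩
  (r + t * (2 * a)) * (r + t * (2 * a))  ≤⟨ +-cancelʳ-≤ slack _ _ with-slack ⟩
  r * r + 4 * k * a * w                  ≤⟨ +-monoˡ-≤ (4 * k * a * w) r²≤4a² ⟩
  4 * a * a + 4 * k * a * w              ≡⟨ +-comm (4 * a * a) _ ⟩
  4 * k * a * w + 4 * a * a              ∎
  where
  open ≤-Reasoning
  k slack : ℕ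
  k = suc a
  slack = 4 * a * a * (t * t)
  square-kd : ∀ k d → k * k * (d * d) ≡ (k * d) * (k * d)
  square-kd = solve-∀
  expand : ∀ r t a → (r + t * (2 * a)) * (r + t * (2 * a)) + 4 * a * a * (t * t)
                   ≡ r * r + 4 * a * ((r + t * (2 * a)) * t)
  expand = solve-∀
  scale : ∀ k w a t → 4 * a * (k * w + a * (t * t)) ≡ 4 * k * a * w + 4 * a * a * (t * t)
  scale = solve-∀
  r²≤4a² : r * r ≤ 4 * a * a
  r²≤4a² = subst (r * r ≤_) (double-square a) (*-mono-≤ (<⇒≤ r<2a) (<⇒≤ r<2a))
    where double-square : ∀ a → (2 * a) * (2 * a) ≡ 4 * a * a
          double-square = solve-∀
  scaled : 4 * a * ((r + t * (2 * a)) * t) ≤ 4 * k * a * w + slack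
  scaled = subst₂ _≤_ (cong (λ z → 4 * a * (z * t)) kd≡) (scale k w a t)
                 (*-monoʳ-≤ (4 * a) bound)
  with-slack : (r + t * (2 * a)) * (r + t * (2 * a)) + slack ≤ r * r + 4 * k * a * w + slack
  with-slack = begin
    (r + t * (2 * a)) * (r + t * (2 * a)) + slack ≡⟨ expand r t a ⟩
    r * r + 4 * a * ((r + t * (2 * a)) * t)       ≤⟨ +-monoʳ-≤ (r * r) scaled ⟩
    r * r + (4 * k * a * w + slack)               ≡⟨ +-assoc (r * r) _ slack ⟨
    r * r + 4 * k * a * w + slack                 ∎

-- Choosing t = ⌊kd/(2a)⌋ ≤ d in  kdt ≤ kw + at²  (k = a + 1) gives  k²d² ≤ 4kaw + 4a².
optimise : ∀ m d w → let a = suc m ; k = suc a in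
           (∀ t → t ≤ d → k * d * t ≤ k * w + a * (t * t)) →
           k * k * (d * d) ≤ 4 * k * a * w + 4 * a * a
optimise m d w bound = completed-square a d w t r kd≡ (m%n<n (k * d) (2 * a)) (bound t t≤d)
  where
  a k t r : ℕ
  a = suc m
  k = suc a
  t = (k * d) / (2 * a)
  r = (k * d) % (2 * a)
  kd≡ : k * d ≡ r + t * (2 * a)
  kd≡ = m≡m%n+[m/n]*n (k * d) (2 * a)
  t≤d : t ≤ d
  t≤d = *-cancelʳ-≤ t d (2 * a) (begin
    t * (2 * a)      ≤⟨ m≤n+m _ r ⟩
    r + t * (2 * a)  ≡⟨ kd≡ ⟨
    k * d            ≤⟨ *-monoˡ-≤ d k≤2a ⟩
    2 * a * d        ≡⟨ *-comm (2 * a) d ⟩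
    d * (2 * a)      ∎)
    where
    open ≤-Reasoning
    k≤2a : k ≤ 2 * a
    k≤2a = subst (k ≤_) (sym (+-suc a (m + 0))) (s≤s (m≤m+n a (m + 0)))

corollary2p4 : (k : ℕ) → 2 ≤ k → (n : ℕ) → (G : Graph n) → ¬ HasClique G (k + 1) →
    (w d : ℕ) → IsCutwidth G w → IsDegeneracy G d →
    k * k * (d * d) ≤ 4 * k * (k ∸ 1) * w + 4 * (k ∸ 1) * (k ∸ 1)
corollary2p4 (suc (suc m)) (s≤s (s≤s z≤n)) n G noK w d ((π , cw≡w) , _) (core≠∅ , _)
  with minDegreeSet G d core≠∅
... | S , (v , v∈S) , minDeg = optimise m d w λ t t≤d →
  subst (λ c → k * d * t ≤ k * c + suc m * (t * t)) cw≡w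
    (size-bound G noK′ minDeg π t (≤-trans t≤d d≤∣S∣))
  where
  k : ℕ
  k = suc (suc m)
  noK′ : ¬ HasClique G (2 + suc m)
  noK′ = subst (¬_ ∘ HasClique G) (+-comm k 1) noK
  d≤∣S∣ : d ≤ ∣ S ∣
  d≤∣S∣ = ≤-trans (minDeg v v∈S) (deg≤size G S v)
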